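{- For every $\sigma\in G_N$, $\widetilde\Delta_\sigma$ maps $\mathbb{Q}(\mu_N)\hat\otimes_{\mathbb{Q}}\mathfrak{dmr}_0^{[N]}$ into itself, and $\Delta_\sigma$ maps $\mathbb{Q}(\mu_N)\hat\otimes_{\mathbb{Q}}\mathfrak{dmr}_0^{\mu_N}$ into itself.
   Context: Let $N\ge3$, $\mu_N$ the $N$-th roots of unity in $\mathbb{C}$, $\zeta_N=\exp(2\pi i/N)$, $\iota:\{1,\dots,N\}\to\mathbb{Z}/N\mathbb{Z}$ the residue bijection, $G_N=\mathrm{Gal}(\mathbb{Q}(\mu_N)/\mathbb{Q})$. $K\langle\langle L\rangle\rangle$: noncommutative formal power series over the alphabet $L$ with coefficients in $K$; $(\psi\mid w)$ the coefficient of the word $w$. Alphabets $X=\{x_0\}\cup\{x_\zeta:\zeta\in\mu_N\}$, $Y=\{y_{k,\zeta}:k\ge1,\zeta\in\mu_N\}$, $\widetilde X=\{\tilde x\}\cup\{\tilde x_\alpha:\alpha\in\mathbb{Z}/N\mathbb{Z}\}$, $\widetilde Y=\{\tilde y_{k,\alpha}\}$, embeddings $y_{k,\zeta}\mapsto x_0^{k-1}x_\zeta$, $\tilde y_{k,\alpha}\mapsto\tilde x^{k-1}\tilde x_\alpha$, decompositions $\mathbb{Q}\langle\langle X\rangle\rangle=\mathbb{Q}\langle\langle Y\rangle\rangle\oplus\mathbb{Q}\langle\langle X\rangle\rangle x_0$, $\mathbb{Q}\langle\langle \widetilde X\rangle\rangle=\mathbb{Q}\langle\langle \widetilde Y\rangle\rangle\oplus\mathbb{Q}\langle\langle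 \widetilde X\rangle\rangle\tilde x$, projections $\pi_Y,\pi_{\widetilde Y}$. Coproducts (continuous algebra morphisms): $\widehat\Delta_{\sqcup\!\sqcup}$, $\widehat\Delta_{\tilde{\sqcup\!\sqcup}}$ make all letters primitive; $\widehat\Delta_*(y_{k,\zeta})=y_{k,\zeta}\otimes1+1\otimes y_{k,\zeta}+\sum_{k_1+k_2=k,\,k_i\ge1,\,\zeta_1\zeta_2=\zeta}y_{k_1,\zeta_1}\otimes y_{k_2,\zeta_2}$; $\widehat\Delta_{\tilde*}(\tilde y_{k,\alpha})=\tilde y_{k,\alpha}\otimes1+1\otimes\tilde y_{k,\alpha}+\sum_{k_1+k_2=k,\,k_i\ge1}\tilde y_{k_1,\alpha}\otimes\tilde y_{k_2,\alpha}$. $\mathbf p$: linear automorphism, $x_0^{k_1-1}x_{\zeta_1}\cdots x_0^{k_r-1}x_{\zeta_r}x_0^{k_{r+1}-1}\mapsto x_0^{k_1-1}x_{\zeta_1}x_0^{k_2-1}x_{\zeta_1\zeta_2}\cdots x_0^{k_r-1}x_{\zeta_1\cdots\zeta_r}x_0^{k_{r+1}-1}$. $\widetilde{\mathbf q}$: linear automorphism, $\tilde x^{k_1-1}\tilde x_{\alpha_1}\cdots\tilde x^{k_r-1}\tilde x_{\alpha_r}\tilde x^{k_{r+1}-1}\mapsto\tilde x^{k_1-1}\tilde x_{\alpha_1-\alpha_2}\cdots\tilde x^{k_{r-1}-1}\tilde x_{\alpha_{r-1}-\alpha_r}\tilde x^{k_r-1}\tilde x_{\alpha_r}\tilde x^{k_{r+1}-1}$.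 $\mathfrak{dmr}_0^{\mu_N}$: the $\psi\in\mathbb{Q}\langle\langle X\rangle\rangle$ with (i) $(\psi\mid x_0)=(\psi\mid x_1)=0$; (ii) $\psi$ $\widehat\Delta_{\sqcup\!\sqcup}$-primitive; (iii) $(\psi\mid x_\zeta)=(\psi\mid x_{\zeta^{ -1}})$ for all $\zeta$; (iv) $\psi_*:=\pi_Y(\mathbf p^{ -1}\psi)+\sum_{n\ge2}\frac{(-1)^{n-1}}{n}(\psi\mid x_0^{n-1}x_1)y_{1,1}^n$ is $\widehat\Delta_*$-primitive. $\mathfrak{dmr}_0^{[N]}$: the $\tilde\psi\in\mathbb{Q}\langle\langle\widetilde X\rangle\rangle$ with (i) $(\tilde\psi\mid\tilde x)=\sum_\alpha(\tilde\psi\mid\tilde x_\alpha)=0$; (ii) $\tilde\psi$ $\widehat\Delta_{\tilde{\sqcup\!\sqcup}}$-primitive; (iii) $(\tilde\psi\mid\tilde x_\alpha)=(\tilde\psi\mid\tilde x_{ -\alpha})$ for all $\alpha$; (iv) $\tilde\psi_{\tilde*}:=\pi_{\widetilde Y}(\widetilde{\mathbf q}^{ -1}\tilde\psi)+\sum_{n\ge2}\sum_{a,b_1,\dots,b_n=1}^N\frac{(-1)^{n-1}}{nN^{n+1}}(\tilde\psi\mid\tilde x^{n-1}\tilde x_{\iota(a)})\tilde y_{1,\iota(b_1)}\cdots\tilde y_{1,\iota(b_n)}$ is $\widehat\Delta_{\tilde*}$-primitive. For a $\mathbb{Q}$-subspace $V$, $\mathbb{Q}(\mu_N)\hat\otimes_{\mathbb{Q}}V$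 denotes its $\mathbb{Q}(\mu_N)$-span in the corresponding series algebra with $\mathbb{Q}(\mu_N)$ coefficients. Galois actions: for $\sigma\in G_N$ with $\sigma(\zeta_N)=\zeta_N^k$, $\gcd(k,N)=1$, let $\delta$ be the algebra automorphism $x_0\mapsto x_0$, $x_\zeta\mapsto x_{\zeta^k}$ and $\tilde\delta$ the algebra automorphism $\tilde x\mapsto\tilde x$, $\tilde x_\alpha\mapsto\tilde x_{k\alpha}$; $\Delta_\sigma(\sum_wc_ww)=\sum_w\sigma(c_w)\delta(w)$ on $\mathbb{Q}(\mu_N)\langle\langle X\rangle\rangle$ and $\widetilde\Delta_\sigma(\sum_wc_ww)=\sum_w\sigma(c_w)\tilde\delta(w)$ on $\mathbb{Q}(\mu_N)\langle\langle\widetilde X\rangle\rangle$. -}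

module Defs where

open import Level using (Level; _⊔_)
open import Data.Nat as ℕ using (ℕ; zero; suc; NonZero; _∸_)
open import Data.Nat.DivMod using (_mod_)
open import Data.Nat.Coprimality using (Coprime)
open import Data.Fin as Fin using (Fin; toℕ)
open import Data.Integer using (+_; -[1+_])
open import Data.Rational as ℚ using (ℚ; 0ℚ; 1ℚ)
open import Data.List using (List; []; _∷_; _++_; map; replicate; foldr)
open import Data.Maybe using (Maybe; just; nothing)
open import Data.Product using (Σ; ∃; _×_; _,_; proj₁; proj₂)
open import Relation.Binary.PropositionalEquality using (_≡_)
open import Relation.Nullary using (¬_)
open import Algebra.Bundles using (CommutativeRing)
open import Algebra.Morphism.Structures using (module RingMorphisms)

sumℚ : List ℚ → ℚ
sumℚ = foldr ℚ._+_ 0ℚ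

powℚ : ℚ → ℕ → ℚ
powℚ q zero    = 1ℚ
powℚ q (suc n) = q ℚ.* powℚ q n

shuffle : {A : Set} → List A → List A → List (List A)
shuffle []       v        = v ∷ []
shuffle (a ∷ u)  []       = (a ∷ u) ∷ []
shuffle (a ∷ u)  (b ∷ v)  =
  map (a ∷_) (shuffle u (b ∷ v)) ++ map (b ∷_) (shuffle (a ∷ u) v)

-- Quasi-shuffle (stuffle) with a partial contraction of letters
-- (nothing = the contraction term is absent).
quasiShuffle : {A : Set} → (A → A → Maybe A) → List A → List A → List (List A)
quasiShuffle d []       v        = v ∷ []
quasiShuffle d (a ∷ u)  []       = (a ∷ u) ∷ []
quasiShuffle d (a ∷ u)  (b ∷ v)  =
  map (a ∷_) (quasiShuffle d u (b ∷ v))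
  ++ map (b ∷_) (quasiShuffle d (a ∷ u) v)
  ++ contr (d a b)
  where
  contr : Maybe _ → List (List _)
  contr nothing  = []
  contr (just c) = map (c ∷_) (quasiShuffle d u v)

ifEmpty : {A : Set} → List A → ℚ → ℚ
ifEmpty []      q = q
ifEmpty (_ ∷ _) q = 0ℚ

-- A series φ (given by its coefficient function on words) is primitive for
-- the coproduct Δ dual to the product `prod` on words, i.e.
-- Δφ = φ ⊗ 1 + 1 ⊗ φ, read coefficientwise:
-- (Δφ | u ⊗ v) = Σ_{w ∈ prod u v} (φ | w).
IsPrimitiveFor : {A : Set} → (List A → List A → List (List A))
               → (List A → ℚ) → Set
IsPrimitiveFor prod φ =
  ∀ u v → sumℚ (map φ (prod u v)) ≡ ifEmpty v (φ u) ℚ.+ ifEmpty u (φ v)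

module _ (N : ℕ) .{{nz : NonZero N}} where

  -- Z/NZ, represented by Fin N; a : Fin N stands for the residue a, and
  -- (on the μ_N side) for the root of unity ζ_N^a.
  ZN : Set
  ZN = Fin N

  addN : ZN → ZN → ZN
  addN a b = (toℕ a ℕ.+ toℕ b) mod N

  negN : ZN → ZN
  negN a = (N ∸ toℕ a) mod N

  subN : ZN → ZN → ZN
  subN a b = addN a (negN b)

  mulN : ℕ → ZN → ZN
  mulN k a = (k ℕ.* toℕ a) mod N

  zeroN : ZN
  zeroN = 0 mod N

  -- Letters of X (resp. X̃): x0 (resp. x̃) and x_{ζ^a} (resp. x̃_a).
  data Letter : Set where
    x0 : Letter
    xz : ZN → Letter

  Word : Set
  Word = List Letter

  -- Letters of Y (resp. Ỹ): yl k a stands for y_{k+1, ζ^a} (resp. ỹ_{k+1,a}).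
  data YLetter : Set where
    yl : ℕ → ZN → YLetter

  YWord : Set
  YWord = List YLetter

  embedY : YWord → Word
  embedY []             = []
  embedY (yl k a ∷ u)   = replicate k x0 ++ (xz a ∷ embedY u)

  pAux : ZN → Word → Word
  pAux acc []           = []
  pAux acc (x0 ∷ w)     = x0 ∷ pAux acc w
  pAux acc (xz a ∷ w)   = xz (addN acc a) ∷ pAux (addN acc a) w

  pMap : Word → Word
  pMap = pAux zeroN

  qAux : Word → Word × Maybe ZN
  qAux []          = [] , nothing
  qAux (x0 ∷ w)    = (x0 ∷ proj₁ (qAux w)) , proj₂ (qAux w)
  qAux (xz a ∷ w)  = (xz (next (proj₂ (qAux w))) ∷ proj₁ (qAux w)) , just a
    where
    next : Maybe ZN → ZN
    next nothing  = a
    next (just b) = subN a b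

  qMap : Word → Word
  qMap w = proj₁ (qAux w)

  diamondμ : YLetter → YLetter → Maybe YLetter
  diamondμ (yl k a) (yl l b) = just (yl (suc (k ℕ.+ l)) (addN a b))

  diamondN : YLetter → YLetter → Maybe YLetter
  diamondN (yl k a) (yl l b) with Fin._≟_ a b
  ... | Relation.Nullary.yes _ = just (yl (suc (k ℕ.+ l)) a)
  ... | Relation.Nullary.no _  = nothing

  Series : Set
  Series = Word → ℚ

  YSeries : Set
  YSeries = YWord → ℚ

  signOver : ℕ → ℚ
  signOver n with n
  ... | zero  = 0ℚ
  ... | suc m = powℚ (ℚ.- 1ℚ) m ℚ.* (+ 1 ℚ./ suc m)

  invN : ℚ
  invN = + 1 ℚ./ N

  allY11 : YWord → Maybe ℕ
  allY11 []                   = just 0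
  allY11 (yl zero a ∷ u) with Fin._≟_ a zeroN | allY11 u
  ... | Relation.Nullary.yes _ | just n = just (suc n)
  ... | _ | _ = nothing
  allY11 (yl (suc k) a ∷ u)   = nothing

  allY1 : YWord → Maybe ℕ
  allY1 []                  = just 0
  allY1 (yl zero a ∷ u) with allY1 u
  ... | just n  = just (suc n)
  ... | nothing = nothing
  allY1 (yl (suc k) a ∷ u)  = nothing

  allResidues : List ZN
  allResidues = Data.List.tabulate (λ i → i)

  psiStar : Series → YSeries
  psiStar ψ u = ψ (pMap (embedY u)) ℚ.+ corr (allY11 u)
    where
    corr : Maybe ℕ → ℚ
    corr (just (suc (suc m))) =
      signOver (suc (suc m)) ℚ.* ψ (replicate (suc m) x0 ++ (xz zeroN ∷ []))
    corr _ = 0ℚ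

  psiTildeStar : Series → YSeries
  psiTildeStar ψ u = ψ (qMap (embedY u)) ℚ.+ corr (allY1 u)
    where
    corr : Maybe ℕ → ℚ
    corr (just (suc (suc m))) =
      signOver (suc (suc m)) ℚ.* powℚ invN (suc (suc (suc m)))
      ℚ.* sumℚ (map (λ a → ψ (replicate (suc m) x0 ++ (xz a ∷ []))) allResidues)
    corr _ = 0ℚ

  record InDmrMu (ψ : Series) : Set where
    field
      coeff-x0   : ψ (x0 ∷ []) ≡ 0ℚ
      coeff-x1   : ψ (xz zeroN ∷ []) ≡ 0ℚ
      sh-prim    : IsPrimitiveFor shuffle ψ
      symmetric  : ∀ a → ψ (xz a ∷ []) ≡ ψ (xz (negN a) ∷ [])
      st-prim    : IsPrimitiveFor (quasiShuffle diamondμ) (psiStar ψ)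

  record InDmrN (ψ : Series) : Set where
    field
      coeff-x    : ψ (x0 ∷ []) ≡ 0ℚ
      coeff-sum  : sumℚ (map (λ a → ψ (xz a ∷ [])) allResidues) ≡ 0ℚ
      sh-prim    : IsPrimitiveFor shuffle ψ
      symmetric  : ∀ a → ψ (xz a ∷ []) ≡ ψ (xz (negN a) ∷ [])
      st-prim    : IsPrimitiveFor (quasiShuffle diamondN) (psiTildeStar ψ)

  deltaK : ℕ → Word → Word
  deltaK k []          = []
  deltaK k (x0 ∷ w)    = x0 ∷ deltaK k w
  deltaK k (xz a ∷ w)  = xz (mulN k a) ∷ deltaK k w

  -- The coefficient field Q(μ_N), given abstractly.

  module _ {c ℓ : Level} (K : CommutativeRing c ℓ) where
    open CommutativeRing K
    open RingMorphisms ℚ.+-*-rawRing rawRing using (IsRingHomomorphism)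
    open RingMorphisms rawRing rawRing using (IsRingIsomorphism)

    powK : Carrier → ℕ → Carrier
    powK z zero    = 1#
    powK z (suc n) = z * powK z n

    IsField : Set (c ⊔ ℓ)
    IsField = (¬ (1# ≈ 0#)) × (∀ x → ¬ (x ≈ 0#) → ∃ λ y → (x * y) ≈ 1#)

    sumK : List Carrier → Carrier
    sumK = foldr _+_ 0#

    evalPoly : (ℚ → Carrier) → Carrier → List ℚ → Carrier
    evalPoly ι z []       = 0#
    evalPoly ι z (q ∷ qs) = ι q + z * evalPoly ι z qs

    record IsCyclotomicField (ι : ℚ → Carrier) (ζ : Carrier) : Set (c ⊔ ℓ) where
      field
        isField    : IsField
        ι-hom      : IsRingHomomorphism ι
        ζ^N≈1      : powK ζ N ≈ 1#
        ζ-primitive : ∀ d → 0 ℕ.< d → d ℕ.< N → ¬ (powK ζ d ≈ 1#)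
        generated  : ∀ z → ∃ λ (qs : List ℚ) → z ≈ evalPoly ι ζ qs

    record IsGaloisElement (ι : ℚ → Carrier) (σ : Carrier → Carrier) : Set (c ⊔ ℓ) where
      field
        σ-iso   : IsRingIsomorphism σ
        σ-fixQ  : ∀ q → σ (ι q) ≈ ι q

    KSeries : Set c
    KSeries = Word → Carrier

    -- Q(μ_N) ⊗̂ V : the Q(μ_N)-span of the Q-subspace V (given as a predicate),
    -- i.e. finite sums Σ c_i ψ_i with c_i ∈ K and ψ_i ∈ V.
    InSpan : (ι : ℚ → Carrier) → (Series → Set) → KSeries → Set (c ⊔ ℓ)
    InSpan ι V Φ =
      ∃ λ (terms : List (Carrier × Σ Series V)) →
        ∀ w → Φ w ≈ sumK (map (λ t → proj₁ t * ι (proj₁ (proj₂ t) w)) terms)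

    -- Ψ = Δ_σ Φ (resp. Δ̃_σ Φ) for σ(ζ) = ζ^k: Ψ = Σ_w σ(c_w) δ(w),
    -- i.e. (Ψ | δ(w)) = σ((Φ | w)) for every word w (δ is a bijection on words).
    IsGaloisImage : (σ : Carrier → Carrier) → ℕ → KSeries → KSeries → Set ℓ
    IsGaloisImage σ k Φ Ψ = ∀ w → Ψ (deltaK k w) ≈ σ (Φ w)

{-# OPTIONS --safe #-}
module Submission where

-- Write σ(ζ) = ζᵏ and let m be an inverse of k modulo N.  As δ is a bijection on words,
-- Δ_σ Φ is w ↦ σ(Φ(δ⁻¹ w)), where δ⁻¹ relabels every x_a as x_{ma}; since σ is a ring
-- automorphism fixing ℚ, it sends a K-combination Σ cᵢ ψᵢ to Σ σ(cᵢ) (ψᵢ ∘ δ⁻¹).  So it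
-- suffices that both dmr spaces are stable under ψ ↦ ψ ∘ δ⁻¹, which holds for relabelling by
-- any automorphism μ of ℤ/N: relabelling commutes with shuffle and quasi-shuffle (whose
-- contractions only add or compare indices), with p, q̃ and the embedding of Y-words, and it
-- merely permutes the residues summed in condition (i) and in the correction term of ψ̃_{~*}.

open import Defs
open import Level using (Level; 0ℓ)
open import Function using (_∘_)
open import Data.Nat using (ℕ; zero; suc; NonZero; _≤_)
open import Data.Nat.Properties
  using (*-assoc; *-comm; *-zeroʳ; *-suc; +-assoc; *-distribˡ-+; *-identityˡ; m∸n+n≡m; suc-pred; <⇒≤)
open import Data.Nat.DivMod using (_%_; _mod_; m%n%n≡m%n; %-distribˡ-+; %-distribˡ-*; [m+kn]%n≡m%n; [m+n]%n≡m%n; m<n⇒m%n≡m)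
open import Data.Nat.Coprimality using (Coprime; coprime-Bézout)
open import Data.Nat.GCD using (module Bézout)
open import Data.Nat.Tactic.RingSolver using (solve-∀)
open import Data.Fin as Fin using (Fin; toℕ)
open import Data.Fin.Permutation using (permutation)
open import Data.Fin.Properties using (toℕ-fromℕ<; toℕ-injective; toℕ<n)
open import Data.Rational as ℚ using (ℚ; 0ℚ)
open import Data.Rational.Properties using (+-0-commutativeMonoid)
import Algebra.Properties.CommutativeMonoid.Sum as SumProperties
open import Data.List using (List; []; _∷_; _++_; map; replicate; tabulate)
open import Data.List.Properties using (map-tabulate; map-++; map-∘; map-cong; map-id)
open import Data.Maybe as Maybe using (Maybe; just; nothing)
open import Data.Product using (Σ; _×_; _,_; ∃; proj₁; proj₂)
open import Algebra.Bundles using (CommutativeRing)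
open import Algebra.Morphism.Structures using (module RingMorphisms)
open import Relation.Binary.Bundles using (Setoid)
import Relation.Binary.Construct.On as On
open import Relation.Binary.PropositionalEquality
  using (_≡_; _≗_; refl; sym; cong; cong₂; module ≡-Reasoning)
import Relation.Binary.PropositionalEquality as ≡
open import Relation.Nullary using (yes; no; contradiction)
import Relation.Binary.Reasoning.Setoid as SetoidReasoning

module _ {A B : Set} (f : A → B) where

  private
    map-∷ : ∀ a {X X′} → map (map f) X ≡ X′ → map (map f) (map (a ∷_) X) ≡ map (f a ∷_) X′
    map-∷ a {X} refl = ≡.trans (sym (map-∘ X)) (map-∘ X)

    map-∷-++ : ∀ a {X X′ Z Z′} → map (map f) X ≡ X′ → map (map f) Z ≡ Z′ →
               map (map f) (map (a ∷_) X ++ Z) ≡ map (f a ∷_) X′ ++ Z′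
    map-∷-++ a {X} {Z = Z} eX eZ = ≡.trans (map-++ (map f) (map (a ∷_) X) Z) (cong₂ _++_ (map-∷ a eX) eZ)

  map-shuffle : ∀ u v → map (map f) (shuffle u v) ≡ shuffle (map f u) (map f v)
  map-shuffle []      v       = refl
  map-shuffle (a ∷ u) []      = refl
  map-shuffle (a ∷ u) (b ∷ v) = map-∷-++ a (map-shuffle u (b ∷ v)) (map-∷ b (map-shuffle (a ∷ u) v))

  module _ {d : A → A → Maybe A} {d′ : B → B → Maybe B}
           (d-homo : ∀ a b → d′ (f a) (f b) ≡ Maybe.map f (d a b)) where

    map-quasiShuffle : ∀ u v → map (map f) (quasiShuffle d u v) ≡ quasiShuffle d′ (map f u) (map f v)
    map-quasiShuffle []      v       = refl
    map-quasiShuffle (a ∷ u) []      = refl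
    -- The recursive calls come first: under the match on d a b termination is not recognised.
    map-quasiShuffle (a ∷ u) (b ∷ v)
      with map-quasiShuffle u (b ∷ v) | map-quasiShuffle (a ∷ u) v | map-quasiShuffle u v
    ... | ih₁ | ih₂ | ih₃ with d a b | d′ (f a) (f b) | d-homo a b
    ... | nothing | _ | refl = map-∷-++ a ih₁ (map-∷-++ b ih₂ refl)
    ... | just c  | _ | refl = map-∷-++ a ih₁ (map-∷-++ b ih₂ (map-∷ c ih₃))

  ifEmpty-map : ∀ v q → ifEmpty (map f v) q ≡ ifEmpty v q
  ifEmpty-map []      q = refl
  ifEmpty-map (_ ∷ _) q = refl

module _ {A : Set} {prod : List A → List A → List (List A)} where

  IsPrimitiveFor-resp-≗ : ∀ {φ φ′} → φ ≗ φ′ → IsPrimitiveFor prod φ → IsPrimitiveFor prod φ′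
  IsPrimitiveFor-resp-≗ {φ} {φ′} φ≗φ′ φ-prim u v = begin
    sumℚ (map φ′ (prod u v))                  ≡⟨ cong sumℚ (map-cong φ≗φ′ (prod u v)) ⟨
    sumℚ (map φ (prod u v))                   ≡⟨ φ-prim u v ⟩
    ifEmpty v (φ u) ℚ.+ ifEmpty u (φ v)       ≡⟨ cong₂ (λ x y → ifEmpty v x ℚ.+ ifEmpty u y) (φ≗φ′ u) (φ≗φ′ v) ⟩
    ifEmpty v (φ′ u) ℚ.+ ifEmpty u (φ′ v)     ∎
    where open ≡-Reasoning

  IsPrimitiveFor-∘-map : (f : A → A) → (∀ u v → map (map f) (prod u v) ≡ prod (map f u) (map f v)) →
                         ∀ {φ} → IsPrimitiveFor prod φ → IsPrimitiveFor prod (φ ∘ map f)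
  IsPrimitiveFor-∘-map f prod-homo {φ} φ-prim u v = begin
    sumℚ (map (φ ∘ map f) (prod u v))                         ≡⟨ cong sumℚ (map-∘ (prod u v)) ⟩
    sumℚ (map φ (map (map f) (prod u v)))                     ≡⟨ cong (sumℚ ∘ map φ) (prod-homo u v) ⟩
    sumℚ (map φ (prod (map f u) (map f v)))                   ≡⟨ φ-prim (map f u) (map f v) ⟩
    ifEmpty (map f v) (φ (map f u)) ℚ.+ ifEmpty (map f u) (φ (map f v))
      ≡⟨ cong₂ ℚ._+_ (ifEmpty-map f v _) (ifEmpty-map f u _) ⟩
    ifEmpty v (φ (map f u)) ℚ.+ ifEmpty u (φ (map f v))       ∎
    where open ≡-Reasoning

module Σℚ = SumProperties +-0-commutativeMonoid

sumℚ-tabulate : ∀ {n} (h : Fin n → ℚ) → sumℚ (tabulate h) ≡ Σℚ.sum h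
sumℚ-tabulate {zero}  h = refl
sumℚ-tabulate {suc n} h = cong (h Fin.zero ℚ.+_) (sumℚ-tabulate (h ∘ Fin.suc))

sumℚ-allResidues : ∀ {N} .{{_ : NonZero N}} (g : ZN N → ℚ) → sumℚ (map g (allResidues N)) ≡ Σℚ.sum g
sumℚ-allResidues g = ≡.trans (cong sumℚ (map-tabulate (λ a → a) g)) (sumℚ-tabulate g)

module _ (N : ℕ) .{{_ : NonZero N}} where

  record IsResidueAutomorphism (μ : ZN N → ZN N) : Set where
    field
      inverse    : ZN N → ZN N
      inverseˡ   : ∀ a → inverse (μ a) ≡ a
      inverseʳ   : ∀ a → μ (inverse a) ≡ a
      zeroN-homo : μ (zeroN N) ≡ zeroN N
      addN-homo  : ∀ a b → μ (addN N a b) ≡ addN N (μ a) (μ b)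
      negN-homo  : ∀ a → μ (negN N a) ≡ negN N (μ a)

    injective : ∀ {a b} → μ a ≡ μ b → a ≡ b
    injective {a} {b} μa≡μb = ≡.trans (sym (inverseˡ a)) (≡.trans (cong inverse μa≡μb) (inverseˡ b))

    subN-homo : ∀ a b → μ (subN N a b) ≡ subN N (μ a) (μ b)
    subN-homo a b = ≡.trans (addN-homo a (negN N b)) (cong (addN N (μ a)) (negN-homo b))

    inverse-isResidueAutomorphism : IsResidueAutomorphism inverse
    inverse-isResidueAutomorphism = record
      { inverse    = μ
      ; inverseˡ   = inverseʳ
      ; inverseʳ   = inverseˡ
      ; zeroN-homo = ≡.trans (cong inverse (sym zeroN-homo)) (inverseˡ (zeroN N))
      ; addN-homo  = λ a b → begin
          inverse (addN N a b)                                ≡⟨ cong₂ (λ x y → inverse (addN N x y)) (inverseʳ a) (inverseʳ b) ⟨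
          inverse (addN N (μ (inverse a)) (μ (inverse b)))    ≡⟨ cong inverse (addN-homo (inverse a) (inverse b)) ⟨
          inverse (μ (addN N (inverse a) (inverse b)))        ≡⟨ inverseˡ _ ⟩
          addN N (inverse a) (inverse b)                      ∎
      ; negN-homo  = λ a → begin
          inverse (negN N a)                                  ≡⟨ cong (inverse ∘ negN N) (inverseʳ a) ⟨
          inverse (negN N (μ (inverse a)))                    ≡⟨ cong inverse (negN-homo (inverse a)) ⟨
          inverse (μ (negN N (inverse a)))                    ≡⟨ inverseˡ _ ⟩
          negN N (inverse a)                                  ∎
      }
      where open ≡-Reasoning

    sumℚ-residues-∘ : ∀ g → sumℚ (map (g ∘ μ) (allResidues N)) ≡ sumℚ (map g (allResidues N))
    sumℚ-residues-∘ g = begin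
      sumℚ (map (g ∘ μ) (allResidues N))     ≡⟨ sumℚ-allResidues (g ∘ μ) ⟩
      Σℚ.sum (g ∘ μ)                         ≡⟨ Σℚ.sum-permute g (permutation μ inverse inverseʳ inverseˡ) ⟨
      Σℚ.sum g                               ≡⟨ sumℚ-allResidues g ⟨
      sumℚ (map g (allResidues N))           ∎
      where open ≡-Reasoning

module Residues (N : ℕ) .{{_ : NonZero N}} where

  open import Data.Nat using (_+_; _*_; _∸_; pred)

  ≋-setoid : Setoid 0ℓ 0ℓ
  ≋-setoid = On.setoid (≡.setoid ℕ) (_% N)

  open Setoid ≋-setoid using () renaming (_≈_ to _≋_)
  open SetoidReasoning ≋-setoid

  N≋0 : N ≋ 0
  N≋0 = [m+n]%n≡m%n 0 N

  *N≋0 : ∀ x → x * N ≋ 0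
  *N≋0 x = [m+kn]%n≡m%n 0 x N

  +-cong-≋ : ∀ {x x′ y y′} → x ≋ x′ → y ≋ y′ → x + y ≋ x′ + y′
  +-cong-≋ {x} {x′} {y} {y′} x≋x′ y≋y′ = begin
    x + y                    ≈⟨ %-distribˡ-+ x y N ⟩
    x % N + y % N            ≡⟨ cong₂ _+_ x≋x′ y≋y′ ⟩
    x′ % N + y′ % N          ≈⟨ %-distribˡ-+ x′ y′ N ⟨
    x′ + y′                  ∎

  *-cong-≋ : ∀ {x x′ y y′} → x ≋ x′ → y ≋ y′ → x * y ≋ x′ * y′
  *-cong-≋ {x} {x′} {y} {y′} x≋x′ y≋y′ = begin
    x * y                    ≈⟨ %-distribˡ-* x y N ⟩
    x % N * (y % N)          ≡⟨ cong₂ _*_ x≋x′ y≋y′ ⟩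
    x′ % N * (y′ % N)        ≈⟨ %-distribˡ-* x′ y′ N ⟨
    x′ * y′                  ∎

  -- Adding t * pred N turns + t into + t * N, which is invisible mod N.
  +-cancelʳ-≋ : ∀ x y t → x + t ≋ y + t → x ≋ y
  +-cancelʳ-≋ x y t x+t≋y+t = begin
    x                        ≈⟨ [m+kn]%n≡m%n x t N ⟨
    x + t * N                ≡⟨ shift x ⟩
    x + t + t * pred N       ≈⟨ +-cong-≋ x+t≋y+t refl ⟩
    y + t + t * pred N       ≡⟨ shift y ⟨
    y + t * N                ≈⟨ [m+kn]%n≡m%n y t N ⟩
    y                        ∎
    where
    shift : ∀ z → z + t * N ≡ z + t + t * pred N
    shift z = ≡.trans (cong (λ n → z + t * n) (sym (suc-pred N)))
                (≡.trans (cong (z +_) (*-suc t (pred N))) (sym (+-assoc z t (t * pred N))))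

  toℕ-mod-≋ : ∀ x → toℕ (x mod N) ≋ x
  toℕ-mod-≋ x = ≡.trans (cong (_% N) (toℕ-fromℕ< _)) (m%n%n≡m%n x N)

  ≋⇒mod≡ : ∀ {x y} → x ≋ y → x mod N ≡ y mod N
  ≋⇒mod≡ x≋y = toℕ-injective (≡.trans (toℕ-fromℕ< _) (≡.trans x≋y (sym (toℕ-fromℕ< _))))

  toℕ-mod : ∀ (a : Fin N) → toℕ a mod N ≡ a
  toℕ-mod a = toℕ-injective (≡.trans (toℕ-fromℕ< _) (m<n⇒m%n≡m (toℕ<n a)))

  +≋0⇒mod≡negN : ∀ x (a : Fin N) → x + toℕ a ≋ 0 → x mod N ≡ negN N a
  +≋0⇒mod≡negN x a x+a≋0 = ≋⇒mod≡ (+-cancelʳ-≋ x (N ∸ toℕ a) (toℕ a) (begin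
    x + toℕ a                ≈⟨ x+a≋0 ⟩
    0                        ≈⟨ N≋0 ⟨
    N                        ≡⟨ m∸n+n≡m (<⇒≤ (toℕ<n a)) ⟨
    N ∸ toℕ a + toℕ a        ∎))

  mulN-addN : ∀ k a b → mulN N k (addN N a b) ≡ addN N (mulN N k a) (mulN N k b)
  mulN-addN k a b = ≋⇒mod≡ (begin
    k * toℕ (addN N a b)                      ≈⟨ *-cong-≋ {k} refl (toℕ-mod-≋ _) ⟩
    k * (toℕ a + toℕ b)                       ≡⟨ *-distribˡ-+ k (toℕ a) (toℕ b) ⟩
    k * toℕ a + k * toℕ b                     ≈⟨ +-cong-≋ (toℕ-mod-≋ _) (toℕ-mod-≋ _) ⟨
    toℕ (mulN N k a) + toℕ (mulN N k b)       ∎)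

  mulN-zeroN : ∀ k → mulN N k (zeroN N) ≡ zeroN N
  mulN-zeroN k = ≋⇒mod≡ (≡.trans (*-cong-≋ {k} refl (toℕ-mod-≋ 0)) (cong (_% N) (*-zeroʳ k)))

  mulN-negN : ∀ k a → mulN N k (negN N a) ≡ negN N (mulN N k a)
  mulN-negN k a = +≋0⇒mod≡negN _ (mulN N k a) (begin
    k * toℕ (negN N a) + toℕ (mulN N k a)     ≈⟨ +-cong-≋ (*-cong-≋ {k} refl (toℕ-mod-≋ _)) (toℕ-mod-≋ _) ⟩
    k * (N ∸ toℕ a) + k * toℕ a               ≡⟨ *-distribˡ-+ k (N ∸ toℕ a) (toℕ a) ⟨
    k * (N ∸ toℕ a + toℕ a)                   ≡⟨ cong (k *_) (m∸n+n≡m (<⇒≤ (toℕ<n a))) ⟩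
    k * N                                     ≈⟨ *N≋0 k ⟩
    0                                         ∎)

  mulN-inverse : ∀ k m → k * m ≋ 1 → ∀ a → mulN N k (mulN N m a) ≡ a
  mulN-inverse k m km≋1 a = ≡.trans (≋⇒mod≡ (begin
    k * toℕ (mulN N m a)                      ≈⟨ *-cong-≋ {k} refl (toℕ-mod-≋ _) ⟩
    k * (m * toℕ a)                           ≡⟨ *-assoc k m (toℕ a) ⟨
    k * m * toℕ a                             ≈⟨ *-cong-≋ km≋1 refl ⟩
    1 * toℕ a                                 ≡⟨ *-identityˡ (toℕ a) ⟩
    toℕ a                                     ∎)) (toℕ-mod a)

  coprime⇒invertible : ∀ {k} → Coprime k N → ∃ λ m → m * k ≋ 1
  coprime⇒invertible {k} k⊥N with coprime-Bézout k⊥N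
  ... | Bézout.+- x y 1+yN≡xk = x , (begin
    x * k                    ≡⟨ 1+yN≡xk ⟨
    1 + y * N                ≈⟨ [m+kn]%n≡m%n 1 y N ⟩
    1                        ∎)
  -- Here x k ≡ -1, so x (N - 1) ≡ -x inverts k.
  ... | Bézout.-+ x y 1+xk≡yN = x * pred N , +-cancelʳ-≋ _ 1 (pred N) (begin
    x * pred N * k + pred N  ≡⟨ factor x k (pred N) ⟩
    (1 + x * k) * pred N     ≡⟨ cong (_* pred N) 1+xk≡yN ⟩
    y * N * pred N           ≡⟨ swap y N (pred N) ⟩
    y * pred N * N           ≈⟨ *N≋0 (y * pred N) ⟩
    0                        ≈⟨ N≋0 ⟨
    N                        ≡⟨ suc-pred N ⟨
    1 + pred N               ∎)
    where
    factor : ∀ x k t → x * t * k + t ≡ (1 + x * k) * t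
    factor = solve-∀
    swap : ∀ y n t → y * n * t ≡ y * t * n
    swap = solve-∀

  mulN-isResidueAutomorphism : ∀ k m → k * m ≋ 1 → IsResidueAutomorphism N (mulN N k)
  mulN-isResidueAutomorphism k m km≋1 = record
    { inverse    = mulN N m
    ; inverseˡ   = mulN-inverse m k (≡.trans (cong (_% N) (*-comm m k)) km≋1)
    ; inverseʳ   = mulN-inverse k m km≋1
    ; zeroN-homo = mulN-zeroN k
    ; addN-homo  = mulN-addN k
    ; negN-homo  = mulN-negN k
    }

  coprime⇒mulN-isResidueAutomorphism : ∀ {k} → Coprime k N → IsResidueAutomorphism N (mulN N k)
  coprime⇒mulN-isResidueAutomorphism {k} k⊥N with coprime⇒invertible k⊥N
  ... | m , mk≋1 = mulN-isResidueAutomorphism k m (≡.trans (cong (_% N) (*-comm k m)) mk≋1)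

open Residues using (coprime⇒mulN-isResidueAutomorphism)

module Relabelling (N : ℕ) .{{_ : NonZero N}} where

  open import Data.Nat using (_+_)

  relabelLetter : (ZN N → ZN N) → Letter N → Letter N
  relabelLetter μ x0     = x0
  relabelLetter μ (xz a) = xz (μ a)

  relabel : (ZN N → ZN N) → Word N → Word N
  relabel μ = map (relabelLetter μ)

  relabelYLetter : (ZN N → ZN N) → YLetter N → YLetter N
  relabelYLetter μ (yl j a) = yl j (μ a)

  relabelY : (ZN N → ZN N) → YWord N → YWord N
  relabelY μ = map (relabelYLetter μ)

  deltaK≗relabel : ∀ k → deltaK N k ≗ relabel (mulN N k)
  deltaK≗relabel k []         = refl
  deltaK≗relabel k (x0 ∷ w)   = cong (x0 ∷_) (deltaK≗relabel k w)
  deltaK≗relabel k (xz a ∷ w) = cong (xz (mulN N k a) ∷_) (deltaK≗relabel k w)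

  relabel-x0ʲ : ∀ μ j w → relabel μ (replicate j x0 ++ w) ≡ replicate j x0 ++ relabel μ w
  relabel-x0ʲ μ zero    w = refl
  relabel-x0ʲ μ (suc j) w = cong (x0 ∷_) (relabel-x0ʲ μ j w)

  relabel-embedY : ∀ μ u → relabel μ (embedY N u) ≡ embedY N (relabelY μ u)
  relabel-embedY μ []           = refl
  relabel-embedY μ (yl j a ∷ u) = ≡.trans (relabel-x0ʲ μ j _)
    (cong (λ w → replicate j x0 ++ xz (μ a) ∷ w) (relabel-embedY μ u))

  allY1-relabelY : ∀ μ u → allY1 N (relabelY μ u) ≡ allY1 N u
  allY1-relabelY μ []                 = refl
  allY1-relabelY μ (yl zero a ∷ u)    rewrite allY1-relabelY μ u = refl
  allY1-relabelY μ (yl (suc j) a ∷ u) = refl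

  module _ {μ : ZN N → ZN N} (μ-aut : IsResidueAutomorphism N μ) where
    open IsResidueAutomorphism μ-aut

    relabel-inverseʳ : ∀ w → relabel μ (relabel inverse w) ≡ w
    relabel-inverseʳ w = ≡.trans (sym (map-∘ w)) (≡.trans (map-cong inverseʳ-letter w) (map-id w))
      where
      inverseʳ-letter : ∀ l → relabelLetter μ (relabelLetter inverse l) ≡ l
      inverseʳ-letter x0     = refl
      inverseʳ-letter (xz a) = cong xz (inverseʳ a)

    relabel-pAux : ∀ acc w → relabel μ (pAux N acc w) ≡ pAux N (μ acc) (relabel μ w)
    relabel-pAux acc []         = refl
    relabel-pAux acc (x0 ∷ w)   = cong (x0 ∷_) (relabel-pAux acc w)
    relabel-pAux acc (xz a ∷ w) rewrite relabel-pAux (addN N acc a) w | addN-homo acc a = refl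

    relabel-pMap : ∀ w → relabel μ (pMap N w) ≡ pMap N (relabel μ w)
    relabel-pMap w = ≡.trans (relabel-pAux (zeroN N) w) (cong (λ acc → pAux N acc (relabel μ w)) zeroN-homo)

    qAux-relabel : ∀ w → qAux N (relabel μ w) ≡ (relabel μ (qMap N w) , Maybe.map μ (proj₂ (qAux N w)))
    qAux-relabel []         = refl
    qAux-relabel (x0 ∷ w)   rewrite qAux-relabel w = refl
    qAux-relabel (xz a ∷ w) rewrite qAux-relabel w with qAux N w
    ... | _ , nothing = refl
    ... | v , just b  = cong (λ c → (xz c ∷ relabel μ v) , just (μ a)) (sym (subN-homo a b))

    relabel-qMap : ∀ w → relabel μ (qMap N w) ≡ qMap N (relabel μ w)
    relabel-qMap w = cong proj₁ (sym (qAux-relabel w))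

    allY11-relabelY : ∀ u → allY11 N (relabelY μ u) ≡ allY11 N u
    allY11-relabelY []                 = refl
    allY11-relabelY (yl (suc j) a ∷ u) = refl
    allY11-relabelY (yl zero a ∷ u)    rewrite allY11-relabelY u
      with a Fin.≟ zeroN N | μ a Fin.≟ zeroN N | allY11 N u
    ... | yes _   | yes _    | just _  = refl
    ... | yes _   | yes _    | nothing = refl
    ... | no _    | no _     | _       = refl
    ... | yes a≡0 | no μa≢0  | _       = contradiction (≡.trans (cong μ a≡0) zeroN-homo) μa≢0
    ... | no a≢0  | yes μa≡0 | _       = contradiction (injective (≡.trans μa≡0 (sym zeroN-homo))) a≢0

    diamondN-relabelY : ∀ x y → diamondN N (relabelYLetter μ x) (relabelYLetter μ y)
                                ≡ Maybe.map (relabelYLetter μ) (diamondN N x y)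
    diamondN-relabelY (yl j a) (yl l b) with a Fin.≟ b | μ a Fin.≟ μ b
    ... | yes _   | yes _    = refl
    ... | no _    | no _     = refl
    ... | yes a≡b | no μa≢μb = contradiction (cong μ a≡b) μa≢μb
    ... | no a≢b  | yes μa≡μb = contradiction (injective μa≡μb) a≢b

    diamondμ-relabelY : ∀ x y → diamondμ N (relabelYLetter μ x) (relabelYLetter μ y)
                                ≡ Maybe.map (relabelYLetter μ) (diamondμ N x y)
    diamondμ-relabelY (yl j a) (yl l b) = cong (λ c → just (yl (suc (j + l)) c)) (sym (addN-homo a b))

    module _ (ψ : Series N) where

      private
        ψ-relabel-x0ʲ : ∀ j a → ψ (relabel μ (replicate j x0 ++ xz a ∷ [])) ≡ ψ (replicate j x0 ++ xz (μ a) ∷ [])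
        ψ-relabel-x0ʲ j a = cong ψ (relabel-x0ʲ μ j (xz a ∷ []))

        ψ-relabel-pMap : ∀ u → ψ (relabel μ (pMap N (embedY N u))) ≡ ψ (pMap N (embedY N (relabelY μ u)))
        ψ-relabel-pMap u = cong ψ (≡.trans (relabel-pMap (embedY N u)) (cong (pMap N) (relabel-embedY μ u)))

        ψ-relabel-qMap : ∀ u → ψ (relabel μ (qMap N (embedY N u))) ≡ ψ (qMap N (embedY N (relabelY μ u)))
        ψ-relabel-qMap u = cong ψ (≡.trans (relabel-qMap (embedY N u)) (cong (qMap N) (relabel-embedY μ u)))

      psiStar-relabel : ∀ u → psiStar N (ψ ∘ relabel μ) u ≡ psiStar N ψ (relabelY μ u)
      psiStar-relabel u rewrite allY11-relabelY u with allY11 N u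
      ... | nothing            = cong (ℚ._+ 0ℚ) (ψ-relabel-pMap u)
      ... | just zero          = cong (ℚ._+ 0ℚ) (ψ-relabel-pMap u)
      ... | just (suc zero)    = cong (ℚ._+ 0ℚ) (ψ-relabel-pMap u)
      ... | just (suc (suc j)) = cong₂ ℚ._+_ (ψ-relabel-pMap u) (cong (signOver N (suc (suc j)) ℚ.*_)
          (≡.trans (ψ-relabel-x0ʲ (suc j) (zeroN N)) (cong (λ c → ψ (replicate (suc j) x0 ++ xz c ∷ [])) zeroN-homo)))

      psiTildeStar-relabel : ∀ u → psiTildeStar N (ψ ∘ relabel μ) u ≡ psiTildeStar N ψ (relabelY μ u)
      psiTildeStar-relabel u rewrite allY1-relabelY μ u with allY1 N u
      ... | nothing            = cong (ℚ._+ 0ℚ) (ψ-relabel-qMap u)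
      ... | just zero          = cong (ℚ._+ 0ℚ) (ψ-relabel-qMap u)
      ... | just (suc zero)    = cong (ℚ._+ 0ℚ) (ψ-relabel-qMap u)
      ... | just (suc (suc j)) = cong₂ ℚ._+_ (ψ-relabel-qMap u)
          (cong (signOver N (suc (suc j)) ℚ.* powℚ (invN N) (suc (suc (suc j))) ℚ.*_)
            (≡.trans (cong sumℚ (map-cong (ψ-relabel-x0ʲ (suc j)) (allResidues N)))
                     (sumℚ-residues-∘ (λ a → ψ (replicate (suc j) x0 ++ xz a ∷ [])))))

    InDmrMu-relabel : ∀ {ψ} → InDmrMu N ψ → InDmrMu N (ψ ∘ relabel μ)
    InDmrMu-relabel {ψ} ψ∈dmr = record
      { coeff-x0  = coeff-x0
      ; coeff-x1  = ≡.trans (cong (λ c → ψ (xz c ∷ [])) zeroN-homo) coeff-x1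
      ; sh-prim   = IsPrimitiveFor-∘-map (relabelLetter μ) (map-shuffle (relabelLetter μ)) sh-prim
      ; symmetric = λ a → ≡.trans (symmetric (μ a)) (cong (λ c → ψ (xz c ∷ [])) (sym (negN-homo a)))
      ; st-prim   = IsPrimitiveFor-resp-≗ {prod = quasiShuffle (diamondμ N)} (sym ∘ psiStar-relabel ψ)
          (IsPrimitiveFor-∘-map (relabelYLetter μ) (map-quasiShuffle (relabelYLetter μ) diamondμ-relabelY) st-prim)
      }
      where open InDmrMu ψ∈dmr

    InDmrN-relabel : ∀ {ψ} → InDmrN N ψ → InDmrN N (ψ ∘ relabel μ)
    InDmrN-relabel {ψ} ψ∈dmr = record
      { coeff-x   = coeff-x
      ; coeff-sum = ≡.trans (sumℚ-residues-∘ (λ a → ψ (xz a ∷ []))) coeff-sum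
      ; sh-prim   = IsPrimitiveFor-∘-map (relabelLetter μ) (map-shuffle (relabelLetter μ)) sh-prim
      ; symmetric = λ a → ≡.trans (symmetric (μ a)) (cong (λ c → ψ (xz c ∷ [])) (sym (negN-homo a)))
      ; st-prim   = IsPrimitiveFor-resp-≗ {prod = quasiShuffle (diamondN N)} (sym ∘ psiTildeStar-relabel ψ)
          (IsPrimitiveFor-∘-map (relabelYLetter μ) (map-quasiShuffle (relabelYLetter μ) diamondN-relabelY) st-prim)
      }
      where open InDmrN ψ∈dmr

open Relabelling

module _ {N : ℕ} .{{_ : NonZero N}} {c ℓ : Level} (K : CommutativeRing c ℓ)
         {ι : ℚ → CommutativeRing.Carrier K} {σ : CommutativeRing.Carrier K → CommutativeRing.Carrier K}
         (σ-gal : IsGaloisElement N K ι σ) where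
  open CommutativeRing K
  open RingMorphisms rawRing rawRing using (module IsRingIsomorphism)
  open IsRingIsomorphism (IsGaloisElement.σ-iso σ-gal) using (+-homo; *-homo; 0#-homo; ⟦⟧-cong)
  open SetoidReasoning setoid

  InSpan-σ-precompose : (V : Series N → Set) (s : Word N → Word N) → (∀ {ψ} → V ψ → V (ψ ∘ s)) →
                        ∀ {Φ Ψ} → InSpan N K ι V Φ → (∀ w → Ψ w ≈ σ (Φ (s w))) → InSpan N K ι V Ψ
  InSpan-σ-precompose V s stable {Φ} {Ψ} (terms , Φ≈terms) Ψ≈σΦs = map conjugate terms , λ w → begin
    Ψ w                                               ≈⟨ Ψ≈σΦs w ⟩
    σ (Φ (s w))                                       ≈⟨ ⟦⟧-cong (Φ≈terms (s w)) ⟩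
    σ (sumK N K (map (value (s w)) terms))            ≈⟨ σ-sum w terms ⟩
    sumK N K (map (value w) (map conjugate terms))    ∎
    where
    Term : Set _
    Term = Carrier × Σ (Series N) V

    value : Word N → Term → Carrier
    value w (a , ψ , _) = a * ι (ψ w)

    conjugate : Term → Term
    conjugate (a , ψ , ψ∈V) = σ a , ψ ∘ s , stable ψ∈V

    σ-sum : ∀ w ts → σ (sumK N K (map (value (s w)) ts)) ≈ sumK N K (map (value w) (map conjugate ts))
    σ-sum w []                 = 0#-homo
    σ-sum w ((a , ψ , _) ∷ ts) = begin
      σ (a * ι (ψ (s w)) + sumK N K (map (value (s w)) ts))        ≈⟨ +-homo _ _ ⟩
      σ (a * ι (ψ (s w))) + σ (sumK N K (map (value (s w)) ts))    ≈⟨ +-cong σ-term (σ-sum w ts) ⟩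
      σ a * ι (ψ (s w)) + sumK N K (map (value w) (map conjugate ts)) ∎
      where
      σ-term : σ (a * ι (ψ (s w))) ≈ σ a * ι (ψ (s w))
      σ-term = trans (*-homo a _) (*-congˡ (IsGaloisElement.σ-fixQ σ-gal _))

  InSpan-galoisImage : ∀ (V : Series N → Set) {k μ} → deltaK N k ≗ relabel N μ →
                       (μ-aut : IsResidueAutomorphism N μ) →
                       (∀ {ψ} → V ψ → V (ψ ∘ relabel N (IsResidueAutomorphism.inverse μ-aut))) →
                       (Φ Ψ : KSeries N K) → InSpan N K ι V Φ → IsGaloisImage N K σ k Φ Ψ → InSpan N K ι V Ψ
  InSpan-galoisImage V {k} δ≗relabel μ-aut stable Φ Ψ Φ∈span Ψ≈σΦ =
    InSpan-σ-precompose V (relabel N inverse) stable Φ∈span λ w →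
      trans (reflexive (cong Ψ (≡.sym (δ-relabel-inverse w)))) (Ψ≈σΦ (relabel N inverse w))
    where
    open IsResidueAutomorphism μ-aut using (inverse)
    δ-relabel-inverse : ∀ w → deltaK N k (relabel N inverse w) ≡ w
    δ-relabel-inverse w = ≡.trans (δ≗relabel _) (relabel-inverseʳ N μ-aut w)

corollary3p15 : (N : ℕ) .{{_ : NonZero N}} → 3 ≤ N →
    {c ℓ : Level} (K : CommutativeRing c ℓ)
    (ι : ℚ → CommutativeRing.Carrier K) (ζ : CommutativeRing.Carrier K) →
    IsCyclotomicField N K ι ζ →
    (σ : CommutativeRing.Carrier K → CommutativeRing.Carrier K) →
    IsGaloisElement N K ι σ →
    (k : ℕ) → Coprime k N →
    CommutativeRing._≈_ K (σ ζ) (powK N K ζ k) →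
    ((Φ Ψ : KSeries N K) → InSpan N K ι (InDmrN N) Φ →
       IsGaloisImage N K σ k Φ Ψ → InSpan N K ι (InDmrN N) Ψ)
    ×
    ((Φ Ψ : KSeries N K) → InSpan N K ι (InDmrMu N) Φ →
       IsGaloisImage N K σ k Φ Ψ → InSpan N K ι (InDmrMu N) Ψ)
corollary3p15 N _ K ι _ _ σ σ-gal k k⊥N _ =
    InSpan-galoisImage K σ-gal (InDmrN N) (deltaK≗relabel N k) k-aut (InDmrN-relabel N k⁻¹-aut)
  , InSpan-galoisImage K σ-gal (InDmrMu N) (deltaK≗relabel N k) k-aut (InDmrMu-relabel N k⁻¹-aut)
  where
  k-aut : IsResidueAutomorphism N (mulN N k)
  k-aut = coprime⇒mulN-isResidueAutomorphism N k⊥N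

  k⁻¹-aut : IsResidueAutomorphism N (IsResidueAutomorphism.inverse k-aut)
  k⁻¹-aut = IsResidueAutomorphism.inverse-isResidueAutomorphism k-aut
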